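{- Let $\{P_n(x)\}_{n\ge 1}$, $c_n(k)$ and $R_k(n)$ be as defined in the context. For all integers $k\ge1$, $n\ge1$, $$R_k(n)=2^n(k-1)!\,4^{k-1}-\sum_{i=1}^{n}2^{n-i}\frac{(2k+i-2)!}{(k+i-1)!}.$$
   Context: The sequence $\{P_n(x)\}_{n\ge1}$ of rational functions of $x$ is defined by $P_1=P_2=1$ and, for $n\ge 2$: if $n$ is odd, $4(2x+n)P_{n+1}(x)=2(x+n)P_n(x)+(2x+n)P_n(x+1)+(4x+n)\ell_n(x)$; if $n$ is even, $4P_{n+1}(x)=4(x+n)P_n(x)+2(2x+n+1)P_n(x+1)+(4x+n)\ell_{n-1}(x)$. Here for odd $r\ge1$, $\ell_r(x)=\prod_{j=1}^{(r-1)/2}(x+j)$ (the empty product equals $1$). For integers $n,k\ge1$, $c_n(k)=(\frac{n-1}{2})!\prod_{i=1}^{k-1}\frac{n+i}{n+2i}$ if $n$ is odd and $c_n(k)=\frac12(\frac n2-1)!\prod_{i=0}^{k-1}\frac{n+i}{n+2i+1}$ if $n$ is even, and $R_k(n)$ is defined by $R_k(n)=(2k-2)!!\left(2^{n+k-1}-P_n(k)/c_n(k)\right)$, where $(2k-2)!!=2^{k-1}(k-1)!$. -}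

module Defs where

open import Data.Nat as ℕ using (ℕ; zero; suc; _∸_)
open import Data.Nat using (_!)
open import Data.Integer using (+_)
open import Data.Rational using (ℚ; 0ℚ; 1ℚ; _+_; _*_; _-_; _÷_; ≢-nonZero)
open import Data.Rational.Properties using (_≟_)
open import Relation.Nullary using (yes; no)
open import Data.Bool using (Bool; if_then_else_)

⟦_⟧ : ℕ → ℚ
⟦ n ⟧ = Data.Rational._/_ (+ n) 1

-- division of rationals; junk value 0 when the divisor is 0
-- (all divisions below have nonzero divisors in the relevant range)
_÷'_ : ℚ → ℚ → ℚ
p ÷' q with q ≟ 0ℚ
... | yes _ = 0ℚ
... | no q≢0 = _÷_ p q {{≢-nonZero q≢0}}

infixl 7 _÷'_

-- ∏_{i=a}^{b} f i  (empty product = 1 when b < a)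
∏[_to_] : ℕ → ℕ → (ℕ → ℚ) → ℚ
∏[ a to b ] f = go (suc b ∸ a)
  where
  go : ℕ → ℚ
  go zero = 1ℚ
  go (suc m) = go m * f (a ℕ.+ m)

-- ∑_{i=a}^{b} f i  (empty sum = 0 when b < a)
∑[_to_] : ℕ → ℕ → (ℕ → ℚ) → ℚ
∑[ a to b ] f = go (suc b ∸ a)
  where
  go : ℕ → ℚ
  go zero = 0ℚ
  go (suc m) = go m + f (a ℕ.+ m)

odd : ℕ → Bool
odd n = n ℕ.% 2 ℕ.≡ᵇ 1

ℓ : ℕ → ℚ → ℚ
ℓ r x = ∏[ 1 to (r ∸ 1) ℕ./ 2 ] (λ j → x + ⟦ j ⟧)

-- The recursion step producing P_{n+1} from P_n (n ≥ 2)
step : ℕ → (ℚ → ℚ) → ℚ → ℚ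
step n Pn x =
  if odd n
  then (⟦ 2 ⟧ * (x + ⟦ n ⟧) * Pn x + (⟦ 2 ⟧ * x + ⟦ n ⟧) * Pn (x + 1ℚ)
          + (⟦ 4 ⟧ * x + ⟦ n ⟧) * ℓ n x) ÷' (⟦ 4 ⟧ * (⟦ 2 ⟧ * x + ⟦ n ⟧))
  else (⟦ 4 ⟧ * (x + ⟦ n ⟧) * Pn x + ⟦ 2 ⟧ * (⟦ 2 ⟧ * x + ⟦ n ⟧ + 1ℚ) * Pn (x + 1ℚ)
          + (⟦ 4 ⟧ * x + ⟦ n ⟧) * ℓ (n ∸ 1) x) ÷' ⟦ 4 ⟧

-- P n x = P_n(x), the rational functions evaluated at rational x
-- (P 0 is a junk value; the sequence is indexed by n ≥ 1)
P : ℕ → ℚ → ℚ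
P zero x = 0ℚ
P (suc zero) x = 1ℚ
P (suc (suc zero)) x = 1ℚ
P (suc (suc (suc m))) x = step (suc (suc m)) (P (suc (suc m))) x

c : ℕ → ℕ → ℚ
c n k =
  if odd n
  then ⟦ ((n ∸ 1) ℕ./ 2) ! ⟧ * ∏[ 1 to k ∸ 1 ] (λ i → ⟦ n ℕ.+ i ⟧ ÷' ⟦ n ℕ.+ 2 ℕ.* i ⟧)
  else (1ℚ ÷' ⟦ 2 ⟧) * ⟦ ((n ℕ./ 2) ∸ 1) ! ⟧
         * ∏[ 0 to k ∸ 1 ] (λ i → ⟦ n ℕ.+ i ⟧ ÷' ⟦ n ℕ.+ 2 ℕ.* i ℕ.+ 1 ⟧)

-- (2k-2)!! = 2^(k-1) (k-1)!
dfact : ℕ → ℕ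
dfact k = 2 ℕ.^ (k ∸ 1) ℕ.* (k ∸ 1) !

R : ℕ → ℕ → ℚ
R k n = ⟦ dfact k ⟧ * (⟦ 2 ℕ.^ (n ℕ.+ k ∸ 1) ⟧ - P n ⟦ k ⟧ ÷' c n k)

-- Write D_k = (2k-2)!! and T_n(k) for the sum on the right. The theorem amounts to
-- D_k P_n(k) = c_n(k) T_n(k) for k ≥ 1, since c_n(k) ≠ 0 and D_k 2^(n+k-1) = 2^n (k-1)! 4^(k-1). Multiplying the recursion by 2k D_k expresses P_{n+1}(k)
-- through D_k P_n(k) and D_{k+1} P_n(k+1), where the hypothesis applies, and through 2k D_k ℓ(k);
-- everything then collapses to c_{n+1}(k) T_{n+1}(k) by
--   T_{n+1}(k) = 2 T_n(k) + A_{n+1}(k),   T_n(k+1) = 4k T_n(k) - n A_{n+1}(k),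
-- the ratios c_n(k+1)/c_n(k) and c_{n+1}(k)/c_n(k), and 2k D_k ℓ(k) = ε c_n(k) (k+n) A_{n+1}(k)
-- (ε = 1 for odd n, 2 for even n), where A_i(k) = (2k+i-2)!/(k+i-1)! is the i-th summand.
-- The last three facts hold because both sides satisfy the same first-order recurrence in k
-- and agree at k = 1.
module Submission where

module Proof where
  open import Defs
  open import Data.Bool using (true; false; if_then_else_)
  open import Data.Empty using (⊥-elim)
  open import Data.List.Base using (_∷_; [])
  open import Data.Maybe.Base using (just; nothing)
  open import Data.Nat as ℕ using (ℕ; zero; suc; _∸_; _!; _≤_; NonZero)
  import Data.Nat.DivMod as ℕ
  import Data.Nat.Properties as ℕ
  open import Data.Nat.Coprimality using (1-coprimeTo) renaming (sym to coprime-sym)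
  open import Data.Nat.Tactic.RingSolver using () renaming (solve-∀ to ℕ-solve)
  import Data.Integer as ℤ
  import Data.Integer.Properties as ℤ
  open import Data.Product using (∃-syntax; _,_)
  open import Data.Rational using (ℚ; mkℚ; 0ℚ; 1ℚ; _+_; _*_; _-_; 1/_; ≢-nonZero; ↥_)
  open import Data.Rational.Properties
    using (normalize-coprime; /-cong; +-*-commutativeRing; _≟_; *-identityˡ; *-identityʳ; *-zeroʳ; *-zeroˡ;
           *-inverseʳ; *-inverseˡ; *-distribˡ-+; *-assoc; *-comm; +-comm)
  open import Data.Sum using (_⊎_; inj₁; inj₂)
  open import Level using (0ℓ)
  open import Relation.Binary.PropositionalEquality
  open import Relation.Nullary using (yes; no)
  open import Tactic.RingSolver using (solve-∀; solve)
  open import Tactic.RingSolver.Core.AlmostCommutativeRing using (AlmostCommutativeRing; fromCommutativeRing)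

  open ≡-Reasoning

  -- Arithmetic in ℚ

  ℚ-ring : AlmostCommutativeRing 0ℓ 0ℓ
  ℚ-ring = fromCommutativeRing +-*-commutativeRing is-zero
    where
    is-zero : ∀ x → _
    is-zero x with 0ℚ ≟ x
    ... | yes 0≡x = just 0≡x
    ... | no _ = nothing

  ⟦⟧≡mkℚ : ∀ n → ⟦ n ⟧ ≡ mkℚ (ℤ.+ n) 0 (coprime-sym (1-coprimeTo n))
  ⟦⟧≡mkℚ n = normalize-coprime (coprime-sym (1-coprimeTo n))

  ⟦+⟧ : ∀ m n → ⟦ m ℕ.+ n ⟧ ≡ ⟦ m ⟧ + ⟦ n ⟧
  ⟦+⟧ m n = trans (/-cong (sym (cong₂ ℤ._+_ (ℤ.*-identityʳ (ℤ.+ m)) (ℤ.*-identityʳ (ℤ.+ n)))) refl)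
                  (sym (cong₂ _+_ (⟦⟧≡mkℚ m) (⟦⟧≡mkℚ n)))

  ⟦*⟧ : ∀ m n → ⟦ m ℕ.* n ⟧ ≡ ⟦ m ⟧ * ⟦ n ⟧
  ⟦*⟧ m n = trans (/-cong (ℤ.pos-* m n) refl) (sym (cong₂ _*_ (⟦⟧≡mkℚ m) (⟦⟧≡mkℚ n)))

  ⟦suc⟧ : ∀ n → ⟦ suc n ⟧ ≡ ⟦ n ⟧ + 1ℚ
  ⟦suc⟧ n = trans (cong ⟦_⟧ (ℕ.+-comm 1 n)) (⟦+⟧ n 1)

  ⟦2*+⟧ : ∀ k i → ⟦ 2 ℕ.* k ℕ.+ i ⟧ ≡ ⟦ 2 ⟧ * ⟦ k ⟧ + ⟦ i ⟧
  ⟦2*+⟧ k i = trans (⟦+⟧ (2 ℕ.* k) i) (cong (_+ ⟦ i ⟧) (⟦*⟧ 2 k))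

  ⟦⟧≢0 : ∀ n .{{_ : NonZero n}} → ⟦ n ⟧ ≢ 0ℚ
  ⟦⟧≢0 (suc n) eq with cong ↥_ (trans (sym (⟦⟧≡mkℚ (suc n))) eq)
  ... | ()

  *-cancelʳ-≡ : ∀ {x y} z → z ≢ 0ℚ → x * z ≡ y * z → x ≡ y
  *-cancelʳ-≡ {x} {y} z z≢0 eq = begin
    x                ≡⟨ regroup x ⟩
    x * z * z⁻¹      ≡⟨ cong (_* z⁻¹) eq ⟩
    y * z * z⁻¹      ≡⟨ regroup y ⟨
    y                ∎
    where
    z⁻¹ = (1/ z) {{≢-nonZero z≢0}}
    regroup : ∀ w → w ≡ w * z * z⁻¹
    regroup w = begin
      w                ≡⟨ *-identityʳ w ⟨
      w * 1ℚ           ≡⟨ cong (w *_) (*-inverseʳ z {{≢-nonZero z≢0}}) ⟨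
      w * (z * z⁻¹)    ≡⟨ *-assoc w z z⁻¹ ⟨
      w * z * z⁻¹      ∎

  *-≢0 : ∀ {x y} → x ≢ 0ℚ → y ≢ 0ℚ → x * y ≢ 0ℚ
  *-≢0 {x} {y} x≢0 y≢0 xy≡0 = x≢0 (*-cancelʳ-≡ y y≢0 (trans xy≡0 (sym (*-zeroˡ y))))

  +-≢0 : ∀ m n .{{_ : NonZero n}} → ⟦ m ⟧ + ⟦ n ⟧ ≢ 0ℚ
  +-≢0 m n = subst (_≢ 0ℚ) (⟦+⟧ m n) (⟦⟧≢0 (m ℕ.+ n) {{m+n≢0}})
    where m+n≢0 = ℕ.>-nonZero (ℕ.<-≤-trans (ℕ.>-nonZero⁻¹ n) (ℕ.m≤n+m n m))

  2*+-≢0 : ∀ k n .{{_ : NonZero n}} → ⟦ 2 ⟧ * ⟦ k ⟧ + ⟦ n ⟧ ≢ 0ℚ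
  2*+-≢0 k n = subst (_≢ 0ℚ) (cong (_+ ⟦ n ⟧) (⟦*⟧ 2 k)) (+-≢0 (2 ℕ.* k) n)

  2*++1-≢0 : ∀ k n → ⟦ 2 ⟧ * ⟦ k ⟧ + ⟦ n ⟧ + 1ℚ ≢ 0ℚ
  2*++1-≢0 k n = subst (_≢ 0ℚ) (cong (_+ 1ℚ) (⟦2*+⟧ k n)) (+-≢0 (2 ℕ.* k ℕ.+ n) 1)

  ÷'-*-cancel : ∀ p {q} → q ≢ 0ℚ → p ÷' q * q ≡ p
  ÷'-*-cancel p {q} q≢0 with q ≟ 0ℚ
  ... | yes q≡0 = ⊥-elim (q≢0 q≡0)
  ... | no q≢0′ = begin
    p * q⁻¹ * q      ≡⟨ *-assoc p q⁻¹ q ⟩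
    p * (q⁻¹ * q)    ≡⟨ cong (p *_) (*-inverseˡ q {{≢-nonZero q≢0′}}) ⟩
    p * 1ℚ           ≡⟨ *-identityʳ p ⟩
    p                ∎
    where q⁻¹ = (1/ q) {{≢-nonZero q≢0′}}

  ÷'-cast-cancel : ∀ p q {a b} .{{_ : NonZero q}} → ⟦ p ⟧ ≡ a → ⟦ q ⟧ ≡ b → (⟦ p ⟧ ÷' ⟦ q ⟧) * b ≡ a
  ÷'-cast-cancel p q refl refl = ÷'-*-cancel ⟦ p ⟧ (⟦⟧≢0 q)

  +-vanishing : ∀ x c {a b} → a ≡ b → x + c * (a - b) ≡ x
  +-vanishing x c {a} refl = x+c*[a-a]≡x x c a
    where
    x+c*[a-a]≡x : ∀ x c a → x + c * (a - a) ≡ x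
    x+c*[a-a]≡x = solve-∀ ℚ-ring

  *-[-÷'] : ∀ D Q p c t → c ≢ 0ℚ → D * p ≡ c * t → D * (Q - p ÷' c) ≡ D * Q - t
  *-[-÷'] D Q p c t c≢0 Dp≡ct = trans (distrib D Q (p ÷' c)) (cong (D * Q -_) D*[p÷'c]≡t)
    where
    distrib : ∀ D Q x → D * (Q - x) ≡ D * Q - D * x
    distrib = solve-∀ ℚ-ring
    D*[p÷'c]≡t : D * (p ÷' c) ≡ t
    D*[p÷'c]≡t = *-cancelʳ-≡ c c≢0 (begin
      D * (p ÷' c) * c    ≡⟨ *-assoc D (p ÷' c) c ⟩
      D * (p ÷' c * c)    ≡⟨ cong (D *_) (÷'-*-cancel p c≢0) ⟩
      D * p               ≡⟨ Dp≡ct ⟩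
      c * t               ≡⟨ *-comm c t ⟩
      t * c               ∎)

  -- Sums and first-order recurrences

  ∑-scale : ∀ p x {f g : ℕ → ℚ} → (∀ i → i ≤ p → f i ≡ x * g i) → ∑[ 1 to p ] f ≡ x * ∑[ 1 to p ] g
  ∑-scale zero x f≡xg = sym (*-zeroʳ x)
  ∑-scale (suc p) x {f} {g} f≡xg = begin
    ∑[ 1 to p ] f + f (suc p)              ≡⟨ cong₂ _+_ (∑-scale p x (λ i i≤p → f≡xg i (ℕ.m≤n⇒m≤1+n i≤p)))
                                                       (f≡xg (suc p) ℕ.≤-refl) ⟩
    x * ∑[ 1 to p ] g + x * g (suc p)      ≡⟨ *-distribˡ-+ x (∑[ 1 to p ] g) (g (suc p)) ⟨
    x * (∑[ 1 to p ] g + g (suc p))        ∎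

  ≡-by-recurrence : ∀ {f g : ℕ → ℚ} (u v : ℕ → ℚ) → (∀ k → u k ≢ 0ℚ) →
                    (∀ k → .{{_ : NonZero k}} → f (suc k) * u k ≡ f k * v k) →
                    (∀ k → .{{_ : NonZero k}} → g (suc k) * u k ≡ g k * v k) →
                    f 1 ≡ g 1 → ∀ k → .{{_ : NonZero k}} → f k ≡ g k
  ≡-by-recurrence u v u≢0 f-rec g-rec f1≡g1 (suc zero) = f1≡g1
  ≡-by-recurrence {f} {g} u v u≢0 f-rec g-rec f1≡g1 (suc k@(suc _)) = *-cancelʳ-≡ (u k) (u≢0 k) (begin
    f (suc k) * u k  ≡⟨ f-rec k ⟩
    f k * v k        ≡⟨ cong (_* v k) (≡-by-recurrence {f} {g} u v u≢0 f-rec g-rec f1≡g1 k) ⟩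
    g k * v k        ≡⟨ g-rec k ⟨
    g (suc k) * u k  ∎)

  ≢0-by-recurrence : ∀ {f : ℕ → ℚ} (u v : ℕ → ℚ) → (∀ k → v k ≢ 0ℚ) →
                     (∀ k → .{{_ : NonZero k}} → f (suc k) * u k ≡ f k * v k) →
                     f 1 ≢ 0ℚ → ∀ k → .{{_ : NonZero k}} → f k ≢ 0ℚ
  ≢0-by-recurrence u v v≢0 f-rec f1≢0 (suc zero) = f1≢0
  ≢0-by-recurrence {f} u v v≢0 f-rec f1≢0 (suc k@(suc _)) fk+1≡0 =
    *-≢0 (≢0-by-recurrence {f} u v v≢0 f-rec f1≢0 k) (v≢0 k)
         (trans (sym (f-rec k)) (trans (cong (_* u k) fk+1≡0) (*-zeroˡ (u k))))

  -- Factorial ratios and the sum T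

  fact-ratio : ℕ → ℕ → ℚ
  fact-ratio p q = ⟦ p ! ⟧ ÷' ⟦ q ! ⟧

  ⟦!⟧≢0 : ∀ p → ⟦ p ! ⟧ ≢ 0ℚ
  ⟦!⟧≢0 p = ⟦⟧≢0 (p !) {{p ℕ.!≢0}}

  ⟦suc!⟧ : ∀ p → ⟦ suc p ! ⟧ ≡ ⟦ suc p ⟧ * ⟦ p ! ⟧
  ⟦suc!⟧ p = ⟦*⟧ (suc p) (p !)

  ⟦suc!⟧*2 : ∀ m → ⟦ suc m ! ⟧ * ⟦ 2 ⟧ ≡ ⟦ m ! ⟧ * ⟦ 2 ℕ.+ 2 ℕ.* m ⟧
  ⟦suc!⟧*2 m = begin
    ⟦ suc m ! ⟧ * ⟦ 2 ⟧              ≡⟨ ⟦*⟧ (suc m !) 2 ⟨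
    ⟦ suc m ! ℕ.* 2 ⟧                ≡⟨ cong ⟦_⟧ (regroup m (m !)) ⟩
    ⟦ m ! ℕ.* (2 ℕ.+ 2 ℕ.* m) ⟧      ≡⟨ ⟦*⟧ (m !) (2 ℕ.+ 2 ℕ.* m) ⟩
    ⟦ m ! ⟧ * ⟦ 2 ℕ.+ 2 ℕ.* m ⟧      ∎
    where
    regroup : ∀ m f → suc m ℕ.* f ℕ.* 2 ≡ f ℕ.* (2 ℕ.+ 2 ℕ.* m)
    regroup = ℕ-solve

  fact-ratio-* : ∀ p q → fact-ratio p q * ⟦ q ! ⟧ ≡ ⟦ p ! ⟧
  fact-ratio-* p q = ÷'-*-cancel ⟦ p ! ⟧ (⟦!⟧≢0 q)

  fact-ratio-self : ∀ p → fact-ratio p p ≡ 1ℚ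
  fact-ratio-self p = *-cancelʳ-≡ ⟦ p ! ⟧ (⟦!⟧≢0 p) (trans (fact-ratio-* p p) (sym (*-identityˡ ⟦ p ! ⟧)))

  fact-ratio-sucˡ : ∀ p q → fact-ratio (suc p) q ≡ ⟦ suc p ⟧ * fact-ratio p q
  fact-ratio-sucˡ p q = *-cancelʳ-≡ ⟦ q ! ⟧ (⟦!⟧≢0 q) (begin
    fact-ratio (suc p) q * ⟦ q ! ⟧          ≡⟨ fact-ratio-* (suc p) q ⟩
    ⟦ suc p ! ⟧                             ≡⟨ ⟦suc!⟧ p ⟩
    ⟦ suc p ⟧ * ⟦ p ! ⟧                     ≡⟨ cong (⟦ suc p ⟧ *_) (fact-ratio-* p q) ⟨
    ⟦ suc p ⟧ * (fact-ratio p q * ⟦ q ! ⟧)  ≡⟨ *-assoc ⟦ suc p ⟧ (fact-ratio p q) ⟦ q ! ⟧ ⟨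
    ⟦ suc p ⟧ * fact-ratio p q * ⟦ q ! ⟧    ∎)

  fact-ratio-suc : ∀ p q → fact-ratio (suc p) (suc q) * ⟦ suc q ⟧ ≡ fact-ratio p q * ⟦ suc p ⟧
  fact-ratio-suc p q = *-cancelʳ-≡ ⟦ q ! ⟧ (⟦!⟧≢0 q) (begin
    fact-ratio (suc p) (suc q) * ⟦ suc q ⟧ * ⟦ q ! ⟧    ≡⟨ *-assoc (fact-ratio (suc p) (suc q)) ⟦ suc q ⟧ ⟦ q ! ⟧ ⟩
    fact-ratio (suc p) (suc q) * (⟦ suc q ⟧ * ⟦ q ! ⟧)  ≡⟨ cong (fact-ratio (suc p) (suc q) *_) (⟦suc!⟧ q) ⟨
    fact-ratio (suc p) (suc q) * ⟦ suc q ! ⟧            ≡⟨ fact-ratio-* (suc p) (suc q) ⟩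
    ⟦ suc p ! ⟧                                         ≡⟨ ⟦suc!⟧ p ⟩
    ⟦ suc p ⟧ * ⟦ p ! ⟧                                 ≡⟨ cong (⟦ suc p ⟧ *_) (fact-ratio-* p q) ⟨
    ⟦ suc p ⟧ * (fact-ratio p q * ⟦ q ! ⟧)              ≡⟨ rearrange ⟦ suc p ⟧ (fact-ratio p q) ⟦ q ! ⟧ ⟩
    fact-ratio p q * ⟦ suc p ⟧ * ⟦ q ! ⟧                ∎)
    where
    rearrange : ∀ a r b → a * (r * b) ≡ r * a * b
    rearrange = solve-∀ ℚ-ring

  A : ℕ → ℕ → ℚ
  A i k = fact-ratio (2 ℕ.* k ℕ.+ i ∸ 2) (k ℕ.+ i ∸ 1)

  T : ℕ → ℕ → ℚ
  T n k = ∑[ 1 to n ] (λ i → ⟦ 2 ℕ.^ (n ∸ i) ⟧ * A i k)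

  A-suc-suc : ∀ i k → A (suc i) (suc k) ≡ fact-ratio (suc (2 ℕ.* k ℕ.+ i)) (suc (k ℕ.+ i))
  A-suc-suc i k = cong₂ fact-ratio (cong (_∸ 2) (2[1+k]+[1+i]≡3+2k+i k i)) (ℕ.+-suc k i)
    where
    2[1+k]+[1+i]≡3+2k+i : ∀ k i → 2 ℕ.* suc k ℕ.+ suc i ≡ 2 ℕ.+ suc (2 ℕ.* k ℕ.+ i)
    2[1+k]+[1+i]≡3+2k+i = ℕ-solve

  A-2+ : ∀ i k → A (2 ℕ.+ i) k ≡ fact-ratio (2 ℕ.* k ℕ.+ i) (suc (k ℕ.+ i))
  A-2+ i k = cong₂ fact-ratio (cong (_∸ 2) (2k+[2+i]≡2+2k+i k i))
                              (cong (_∸ 1) (trans (ℕ.+-suc k (suc i)) (cong suc (ℕ.+-suc k i))))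
    where
    2k+[2+i]≡2+2k+i : ∀ k i → 2 ℕ.* k ℕ.+ (2 ℕ.+ i) ≡ 2 ℕ.+ (2 ℕ.* k ℕ.+ i)
    2k+[2+i]≡2+2k+i = ℕ-solve

  A-suc-arg : ∀ i k → A (suc i) (suc k) ≡ (⟦ 2 ⟧ * ⟦ k ⟧ + ⟦ i ⟧ + 1ℚ) * A (2 ℕ.+ i) k
  A-suc-arg i k = begin
    A (suc i) (suc k)                                              ≡⟨ A-suc-suc i k ⟩
    fact-ratio (suc (2 ℕ.* k ℕ.+ i)) (suc (k ℕ.+ i))               ≡⟨ fact-ratio-sucˡ (2 ℕ.* k ℕ.+ i) (suc (k ℕ.+ i)) ⟩
    ⟦ suc (2 ℕ.* k ℕ.+ i) ⟧ * fact-ratio (2 ℕ.* k ℕ.+ i) (suc (k ℕ.+ i))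
      ≡⟨ cong₂ _*_ (trans (⟦suc⟧ (2 ℕ.* k ℕ.+ i)) (cong (_+ 1ℚ) (⟦2*+⟧ k i))) (sym (A-2+ i k)) ⟩
    (⟦ 2 ⟧ * ⟦ k ⟧ + ⟦ i ⟧ + 1ℚ) * A (2 ℕ.+ i) k                   ∎

  A-suc-index : ∀ i k .{{_ : NonZero k}} → A (2 ℕ.+ i) k * (⟦ k ⟧ + ⟦ i ⟧ + 1ℚ) ≡ A (suc i) k * (⟦ 2 ⟧ * ⟦ k ⟧ + ⟦ i ⟧)
  A-suc-index i (suc j) = begin
    A (2 ℕ.+ i) (suc j) * (⟦ suc j ⟧ + ⟦ i ⟧ + 1ℚ)
      ≡⟨ cong₂ _*_ (trans (A-2+ i (suc j)) (cong (λ p → fact-ratio p (suc q)) (2[1+j]+i≡2+2j+i j i)))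
                   (sym (trans (⟦suc⟧ q) (cong (_+ 1ℚ) (⟦+⟧ (suc j) i)))) ⟩
    fact-ratio (suc p) (suc q) * ⟦ suc q ⟧    ≡⟨ fact-ratio-suc p q ⟩
    fact-ratio p q * ⟦ suc p ⟧
      ≡⟨ cong₂ _*_ (sym (A-suc-suc i j)) (trans (cong ⟦_⟧ (sym (2[1+j]+i≡2+2j+i j i))) (⟦2*+⟧ (suc j) i)) ⟩
    A (suc i) (suc j) * (⟦ 2 ⟧ * ⟦ suc j ⟧ + ⟦ i ⟧)  ∎
    where
    p = suc (2 ℕ.* j ℕ.+ i)
    q = suc (j ℕ.+ i)
    2[1+j]+i≡2+2j+i : ∀ j i → 2 ℕ.* suc j ℕ.+ i ≡ suc (suc (2 ℕ.* j ℕ.+ i))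
    2[1+j]+i≡2+2j+i = ℕ-solve

  T-suc : ∀ n k → T (suc n) k ≡ ⟦ 2 ⟧ * T n k + A (suc n) k
  T-suc n k = cong₂ _+_ (∑-scale n ⟦ 2 ⟧ doubled) last-term
    where
    doubled : ∀ i → i ≤ n → ⟦ 2 ℕ.^ (suc n ∸ i) ⟧ * A i k ≡ ⟦ 2 ⟧ * (⟦ 2 ℕ.^ (n ∸ i) ⟧ * A i k)
    doubled i i≤n = begin
      ⟦ 2 ℕ.^ (suc n ∸ i) ⟧ * A i k        ≡⟨ cong (λ e → ⟦ 2 ℕ.^ e ⟧ * A i k) (ℕ.+-∸-assoc 1 i≤n) ⟩
      ⟦ 2 ℕ.* 2 ℕ.^ (n ∸ i) ⟧ * A i k      ≡⟨ cong (_* A i k) (⟦*⟧ 2 (2 ℕ.^ (n ∸ i))) ⟩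
      ⟦ 2 ⟧ * ⟦ 2 ℕ.^ (n ∸ i) ⟧ * A i k    ≡⟨ *-assoc ⟦ 2 ⟧ ⟦ 2 ℕ.^ (n ∸ i) ⟧ (A i k) ⟩
      ⟦ 2 ⟧ * (⟦ 2 ℕ.^ (n ∸ i) ⟧ * A i k)  ∎
    last-term : ⟦ 2 ℕ.^ (suc n ∸ suc n) ⟧ * A (suc n) k ≡ A (suc n) k
    last-term = trans (cong (λ e → ⟦ 2 ℕ.^ e ⟧ * A (suc n) k) (ℕ.n∸n≡0 n)) (*-identityˡ (A (suc n) k))

  T-suc-arg : ∀ n k .{{_ : NonZero k}} → T n (suc k) ≡ ⟦ 4 ⟧ * ⟦ k ⟧ * T n k - ⟦ n ⟧ * A (suc n) k
  T-suc-arg zero k = empty-sum ⟦ k ⟧ (A 1 k)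
    where
    empty-sum : ∀ K a → 0ℚ ≡ ⟦ 4 ⟧ * K * 0ℚ - ⟦ 0 ⟧ * a
    empty-sum = solve-∀ ℚ-ring
  T-suc-arg (suc n) k = begin
    T (suc n) (suc k)                                         ≡⟨ T-suc n (suc k) ⟩
    ⟦ 2 ⟧ * T n (suc k) + A (suc n) (suc k)                   ≡⟨ cong₂ (λ t a → ⟦ 2 ⟧ * t + a) (T-suc-arg n k) (A-suc-arg n k) ⟩
    ⟦ 2 ⟧ * (⟦ 4 ⟧ * K * Tₙ - N * A₁) + (⟦ 2 ⟧ * K + N + 1ℚ) * A₂
      ≡⟨ regroup K N Tₙ A₁ A₂ ⟩
    ⟦ 4 ⟧ * K * (⟦ 2 ⟧ * Tₙ + A₁) - (N + 1ℚ) * A₂ + ⟦ 2 ⟧ * (A₂ * (K + N + 1ℚ) - A₁ * (⟦ 2 ⟧ * K + N))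
      ≡⟨ +-vanishing _ ⟦ 2 ⟧ (A-suc-index n k) ⟩
    ⟦ 4 ⟧ * K * (⟦ 2 ⟧ * Tₙ + A₁) - (N + 1ℚ) * A₂            ≡⟨ cong₂ (λ t m → ⟦ 4 ⟧ * K * t - m * A₂) (T-suc n k) (⟦suc⟧ n) ⟨
    ⟦ 4 ⟧ * K * T (suc n) k - ⟦ suc n ⟧ * A₂                  ∎
    where
    K = ⟦ k ⟧
    N = ⟦ n ⟧
    Tₙ = T n k
    A₁ = A (suc n) k
    A₂ = A (2 ℕ.+ n) k
    regroup : ∀ K N T A₁ A₂ → ⟦ 2 ⟧ * (⟦ 4 ⟧ * K * T - N * A₁) + (⟦ 2 ⟧ * K + N + 1ℚ) * A₂
              ≡ ⟦ 4 ⟧ * K * (⟦ 2 ⟧ * T + A₁) - (N + 1ℚ) * A₂ + ⟦ 2 ⟧ * (A₂ * (K + N + 1ℚ) - A₁ * (⟦ 2 ⟧ * K + N))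
    regroup = solve-∀ ℚ-ring

  -- Double factorials and ℓ

  dfact-suc : ∀ k .{{_ : NonZero k}} → ⟦ dfact (suc k) ⟧ ≡ ⟦ 2 ⟧ * ⟦ k ⟧ * ⟦ dfact k ⟧
  dfact-suc (suc j) = begin
    ⟦ 2 ℕ.* 2 ℕ.^ j ℕ.* (suc j ℕ.* j !) ⟧   ≡⟨ cong ⟦_⟧ (regroup j (2 ℕ.^ j) (j !)) ⟩
    ⟦ 2 ℕ.* suc j ℕ.* dfact (suc j) ⟧        ≡⟨ ⟦*⟧ (2 ℕ.* suc j) (dfact (suc j)) ⟩
    ⟦ 2 ℕ.* suc j ⟧ * ⟦ dfact (suc j) ⟧      ≡⟨ cong (_* ⟦ dfact (suc j) ⟧) (⟦*⟧ 2 (suc j)) ⟩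
    ⟦ 2 ⟧ * ⟦ suc j ⟧ * ⟦ dfact (suc j) ⟧    ∎
    where
    regroup : ∀ j a f → 2 ℕ.* a ℕ.* (suc j ℕ.* f) ≡ 2 ℕ.* suc j ℕ.* (a ℕ.* f)
    regroup = ℕ-solve

  4^j≡2^j*2^j : ∀ j → 4 ℕ.^ j ≡ 2 ℕ.^ j ℕ.* 2 ℕ.^ j
  4^j≡2^j*2^j zero = refl
  4^j≡2^j*2^j (suc j) = trans (cong (4 ℕ.*_) (4^j≡2^j*2^j j)) (regroup (2 ℕ.^ j))
    where
    regroup : ∀ b → 4 ℕ.* (b ℕ.* b) ≡ 2 ℕ.* b ℕ.* (2 ℕ.* b)
    regroup = ℕ-solve

  dfact*2^[n+k-1] : ∀ k n .{{_ : NonZero k}} → dfact k ℕ.* 2 ℕ.^ (n ℕ.+ k ∸ 1) ≡ 2 ℕ.^ n ℕ.* (k ∸ 1) ! ℕ.* 4 ℕ.^ (k ∸ 1)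
  dfact*2^[n+k-1] (suc j) n = begin
    2 ℕ.^ j ℕ.* j ! ℕ.* 2 ℕ.^ (n ℕ.+ suc j ∸ 1)        ≡⟨ cong (λ e → 2 ℕ.^ j ℕ.* j ! ℕ.* 2 ℕ.^ (e ∸ 1)) (ℕ.+-suc n j) ⟩
    2 ℕ.^ j ℕ.* j ! ℕ.* 2 ℕ.^ (n ℕ.+ j)                ≡⟨ cong (2 ℕ.^ j ℕ.* j ! ℕ.*_) (ℕ.^-distribˡ-+-* 2 n j) ⟩
    2 ℕ.^ j ℕ.* j ! ℕ.* (2 ℕ.^ n ℕ.* 2 ℕ.^ j)          ≡⟨ regroup (2 ℕ.^ n) (2 ℕ.^ j) (j !) ⟩
    2 ℕ.^ n ℕ.* j ! ℕ.* (2 ℕ.^ j ℕ.* 2 ℕ.^ j)          ≡⟨ cong (2 ℕ.^ n ℕ.* j ! ℕ.*_) (4^j≡2^j*2^j j) ⟨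
    2 ℕ.^ n ℕ.* j ! ℕ.* 4 ℕ.^ j                         ∎
    where
    regroup : ∀ a b f → b ℕ.* f ℕ.* (a ℕ.* b) ≡ a ℕ.* f ℕ.* (b ℕ.* b)
    regroup = ℕ-solve

  rising : ℚ → ℕ → ℚ
  rising x m = ∏[ 1 to m ] (λ j → x + ⟦ j ⟧)

  rising-shift : ∀ x m → rising (x + 1ℚ) m * (x + 1ℚ) ≡ rising x m * (x + ⟦ m ⟧ + 1ℚ)
  rising-shift x zero = empty x
    where
    empty : ∀ x → 1ℚ * (x + 1ℚ) ≡ 1ℚ * (x + ⟦ 0 ⟧ + 1ℚ)
    empty = solve-∀ ℚ-ring
  rising-shift x (suc m) = begin
    rising (x + 1ℚ) m * (x + 1ℚ + ⟦ suc m ⟧) * (x + 1ℚ)  ≡⟨ swap (rising (x + 1ℚ) m) (x + 1ℚ + ⟦ suc m ⟧) (x + 1ℚ) ⟩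
    rising (x + 1ℚ) m * (x + 1ℚ) * (x + 1ℚ + ⟦ suc m ⟧)  ≡⟨ cong₂ (λ r s → r * (x + 1ℚ + s)) (rising-shift x m) (⟦suc⟧ m) ⟩
    rising x m * (x + M + 1ℚ) * (x + 1ℚ + (M + 1ℚ))      ≡⟨ regroup (rising x m) x M ⟩
    rising x m * (x + (M + 1ℚ)) * (x + (M + 1ℚ) + 1ℚ)    ≡⟨ cong (λ s → rising x m * (x + s) * (x + s + 1ℚ)) (⟦suc⟧ m) ⟨
    rising x m * (x + ⟦ suc m ⟧) * (x + ⟦ suc m ⟧ + 1ℚ)  ∎
    where
    M = ⟦ m ⟧
    swap : ∀ r a b → r * a * b ≡ r * b * a
    swap = solve-∀ ℚ-ring
    regroup : ∀ r x M → r * (x + M + 1ℚ) * (x + 1ℚ + (M + 1ℚ)) ≡ r * (x + (M + 1ℚ)) * (x + (M + 1ℚ) + 1ℚ)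
    regroup = solve-∀ ℚ-ring

  rising-one : ∀ m → rising 1ℚ m ≡ ⟦ suc m ! ⟧
  rising-one zero = refl
  rising-one (suc m) = begin
    rising 1ℚ m * (1ℚ + ⟦ suc m ⟧)       ≡⟨ cong₂ _*_ (rising-one m) (sym (⟦+⟧ 1 (suc m))) ⟩
    ⟦ suc m ! ⟧ * ⟦ suc (suc m) ⟧        ≡⟨ *-comm ⟦ suc m ! ⟧ ⟦ suc (suc m) ⟧ ⟩
    ⟦ suc (suc m) ⟧ * ⟦ suc m ! ⟧        ≡⟨ ⟦suc!⟧ (suc m) ⟨
    ⟦ suc (suc m) ! ⟧                    ∎

  half-double : ∀ m → 2 ℕ.* m ℕ./ 2 ≡ m
  half-double m = trans (cong (ℕ._/ 2) (ℕ.*-comm 2 m)) (ℕ.m*n/n≡m m 2)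

  ℓ-odd : ∀ m x → ℓ (suc (2 ℕ.* m)) x ≡ rising x m
  ℓ-odd m x = cong (λ h → ∏[ 1 to h ] (λ j → x + ⟦ j ⟧)) (half-double m)

  dfact-rising-suc : ∀ m k .{{_ : NonZero k}} →
                     ⟦ suc k ⟧ * ⟦ dfact (suc k) ⟧ * rising ⟦ suc k ⟧ m
                     ≡ ⟦ 2 ⟧ * (⟦ k ⟧ + ⟦ m ⟧ + 1ℚ) * (⟦ k ⟧ * ⟦ dfact k ⟧ * rising ⟦ k ⟧ m)
  dfact-rising-suc m k = begin
    ⟦ suc k ⟧ * ⟦ dfact (suc k) ⟧ * rising ⟦ suc k ⟧ m
      ≡⟨ cong₂ (λ x d → x * d * rising x m) (⟦suc⟧ k) (dfact-suc k) ⟩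
    (K + 1ℚ) * (⟦ 2 ⟧ * K * D) * rising (K + 1ℚ) m     ≡⟨ regroup (K + 1ℚ) K D (rising (K + 1ℚ) m) ⟩
    ⟦ 2 ⟧ * K * D * (rising (K + 1ℚ) m * (K + 1ℚ))     ≡⟨ cong (⟦ 2 ⟧ * K * D *_) (rising-shift K m) ⟩
    ⟦ 2 ⟧ * K * D * (rising K m * (K + ⟦ m ⟧ + 1ℚ))    ≡⟨ rearrange K D (rising K m) (K + ⟦ m ⟧ + 1ℚ) ⟩
    ⟦ 2 ⟧ * (K + ⟦ m ⟧ + 1ℚ) * (K * D * rising K m)    ∎
    where
    K = ⟦ k ⟧
    D = ⟦ dfact k ⟧
    regroup : ∀ a K D r → a * (⟦ 2 ⟧ * K * D) * r ≡ ⟦ 2 ⟧ * K * D * (r * a)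
    regroup = solve-∀ ℚ-ring
    rearrange : ∀ K D r s → ⟦ 2 ⟧ * K * D * (r * s) ≡ ⟦ 2 ⟧ * s * (K * D * r)
    rearrange = solve-∀ ℚ-ring

  -- The constants c

  even-or-odd : ∀ n → ∃[ m ] (n ≡ 2 ℕ.* m ⊎ n ≡ suc (2 ℕ.* m))
  even-or-odd zero = 0 , inj₁ refl
  even-or-odd (suc n) with even-or-odd n
  ... | m , inj₁ n≡2m   = m , inj₂ (cong suc n≡2m)
  ... | m , inj₂ n≡1+2m = suc m , inj₁ (trans (cong suc n≡1+2m) (sym (ℕ.*-suc 2 m)))

  odd-1+2m : ∀ m → odd (suc (2 ℕ.* m)) ≡ true
  odd-1+2m m = cong (ℕ._≡ᵇ 1) (trans (cong (λ e → suc e ℕ.% 2) (ℕ.*-comm 2 m)) (ℕ.[m+kn]%n≡m%n 1 m 2))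

  odd-2+2m : ∀ m → odd (2 ℕ.+ 2 ℕ.* m) ≡ false
  odd-2+2m m = cong (ℕ._≡ᵇ 1) (trans (cong (λ e → (2 ℕ.+ e) ℕ.% 2) (ℕ.*-comm 2 m)) (ℕ.[m+kn]%n≡m%n 2 m 2))

  if-true : ∀ {A : Set} {b} {x y : A} → b ≡ true → (if b then x else y) ≡ x
  if-true refl = refl

  if-false : ∀ {A : Set} {b} {x y : A} → b ≡ false → (if b then x else y) ≡ y
  if-false refl = refl

  c-odd : ∀ m k → c (suc (2 ℕ.* m)) k
                  ≡ ⟦ m ! ⟧ * ∏[ 1 to k ∸ 1 ] (λ i → ⟦ suc (2 ℕ.* m) ℕ.+ i ⟧ ÷' ⟦ suc (2 ℕ.* m) ℕ.+ 2 ℕ.* i ⟧)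
  c-odd m k = trans (if-true (odd-1+2m m))
                    (cong (λ h → ⟦ h ! ⟧ * ∏[ 1 to k ∸ 1 ] (λ i → ⟦ suc (2 ℕ.* m) ℕ.+ i ⟧ ÷' ⟦ suc (2 ℕ.* m) ℕ.+ 2 ℕ.* i ⟧))
                          (half-double m))

  c-even : ∀ m k → c (2 ℕ.+ 2 ℕ.* m) k
                   ≡ (1ℚ ÷' ⟦ 2 ⟧) * ⟦ m ! ⟧
                     * ∏[ 0 to k ∸ 1 ] (λ i → ⟦ 2 ℕ.+ 2 ℕ.* m ℕ.+ i ⟧ ÷' ⟦ 2 ℕ.+ 2 ℕ.* m ℕ.+ 2 ℕ.* i ℕ.+ 1 ⟧)
  c-even m k = trans (if-false (odd-2+2m m))
                     (cong (λ h → (1ℚ ÷' ⟦ 2 ⟧) * ⟦ (h ∸ 1) ! ⟧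
                                  * ∏[ 0 to k ∸ 1 ] (λ i → ⟦ 2 ℕ.+ 2 ℕ.* m ℕ.+ i ⟧ ÷' ⟦ 2 ℕ.+ 2 ℕ.* m ℕ.+ 2 ℕ.* i ℕ.+ 1 ⟧))
                           (trans (cong (ℕ._/ 2) (2+2m≡[1+m]*2 m)) (ℕ.m*n/n≡m (suc m) 2)))
    where
    2+2m≡[1+m]*2 : ∀ m → 2 ℕ.+ 2 ℕ.* m ≡ suc m ℕ.* 2
    2+2m≡[1+m]*2 = ℕ-solve

  prefix-product-step : ∀ {c₁ c₀ C Π r d s} → c₁ ≡ C * (Π * r) → c₀ ≡ C * Π → r * d ≡ s → c₁ * d ≡ c₀ * s
  prefix-product-step {c₁} {c₀} {C} {Π} {r} {d} {s} c₁≡ c₀≡ r*d≡s = begin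
    c₁ * d              ≡⟨ cong (_* d) c₁≡ ⟩
    C * (Π * r) * d     ≡⟨ regroup C Π r d ⟩
    C * Π * (r * d)     ≡⟨ cong₂ _*_ (sym c₀≡) r*d≡s ⟩
    c₀ * s              ∎
    where
    regroup : ∀ C Π r d → C * (Π * r) * d ≡ C * Π * (r * d)
    regroup = solve-∀ ℚ-ring

  c-odd-suc-arg : ∀ m k .{{_ : NonZero k}} → let n = suc (2 ℕ.* m) in
                  c n (suc k) * (⟦ 2 ⟧ * ⟦ k ⟧ + ⟦ n ⟧) ≡ c n k * (⟦ k ⟧ + ⟦ n ⟧)
  c-odd-suc-arg m k@(suc j) =
    prefix-product-step {C = ⟦ m ! ⟧} {Π = ∏[ 1 to j ] factor} (c-odd m (suc k)) (c-odd m k)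
      (÷'-cast-cancel (n ℕ.+ k) (n ℕ.+ 2 ℕ.* k) (trans (⟦+⟧ n k) (+-comm ⟦ n ⟧ ⟦ k ⟧))
                      (trans (cong ⟦_⟧ (ℕ.+-comm n (2 ℕ.* k))) (⟦2*+⟧ k n)))
    where
    n = suc (2 ℕ.* m)
    factor : ℕ → ℚ
    factor i = ⟦ n ℕ.+ i ⟧ ÷' ⟦ n ℕ.+ 2 ℕ.* i ⟧

  c-even-suc-arg : ∀ m k .{{_ : NonZero k}} → let n = 2 ℕ.+ 2 ℕ.* m in
                   c n (suc k) * (⟦ 2 ⟧ * ⟦ k ⟧ + ⟦ n ⟧ + 1ℚ) ≡ c n k * (⟦ k ⟧ + ⟦ n ⟧)
  c-even-suc-arg m k@(suc j) =
    prefix-product-step {C = (1ℚ ÷' ⟦ 2 ⟧) * ⟦ m ! ⟧} {Π = ∏[ 0 to j ] factor} (c-even m (suc k)) (c-even m k)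
      (÷'-cast-cancel (n ℕ.+ k) (n ℕ.+ 2 ℕ.* k ℕ.+ 1) (trans (⟦+⟧ n k) (+-comm ⟦ n ⟧ ⟦ k ⟧))
                      (trans (⟦+⟧ (n ℕ.+ 2 ℕ.* k) 1) (cong (_+ 1ℚ) (trans (cong ⟦_⟧ (ℕ.+-comm n (2 ℕ.* k))) (⟦2*+⟧ k n)))))
    where
    n = 2 ℕ.+ 2 ℕ.* m
    factor : ℕ → ℚ
    factor i = ⟦ n ℕ.+ i ⟧ ÷' ⟦ n ℕ.+ 2 ℕ.* i ℕ.+ 1 ⟧

  c-odd-one : ∀ m → c (suc (2 ℕ.* m)) 1 ≡ ⟦ m ! ⟧
  c-odd-one m = trans (c-odd m 1) (*-identityʳ ⟦ m ! ⟧)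

  c-even-one : ∀ m → let n = 2 ℕ.+ 2 ℕ.* m in c n 1 * (⟦ 2 ⟧ * (⟦ n ⟧ + 1ℚ)) ≡ ⟦ m ! ⟧ * ⟦ n ⟧
  c-even-one m = begin
    c n 1 * (⟦ 2 ⟧ * (⟦ n ⟧ + 1ℚ))                                 ≡⟨ cong (_* (⟦ 2 ⟧ * (⟦ n ⟧ + 1ℚ))) (c-even m 1) ⟩
    half * ⟦ m ! ⟧ * (1ℚ * r) * (⟦ 2 ⟧ * (⟦ n ⟧ + 1ℚ))             ≡⟨ regroup half ⟦ m ! ⟧ r ⟦ 2 ⟧ (⟦ n ⟧ + 1ℚ) ⟩
    half * ⟦ 2 ⟧ * ⟦ m ! ⟧ * (r * (⟦ n ⟧ + 1ℚ))                    ≡⟨ cong₂ (λ h s → h * ⟦ m ! ⟧ * s) (÷'-*-cancel 1ℚ (⟦⟧≢0 2))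
                                                                            (÷'-cast-cancel (n ℕ.+ 0) (n ℕ.+ 0 ℕ.+ 1) n+0≡n n+0+1≡n+1) ⟩
    1ℚ * ⟦ m ! ⟧ * ⟦ n ⟧                                            ≡⟨ cong (_* ⟦ n ⟧) (*-identityˡ ⟦ m ! ⟧) ⟩
    ⟦ m ! ⟧ * ⟦ n ⟧                                                 ∎
    where
    n = 2 ℕ.+ 2 ℕ.* m
    half = 1ℚ ÷' ⟦ 2 ⟧
    r = ⟦ n ℕ.+ 0 ⟧ ÷' ⟦ n ℕ.+ 0 ℕ.+ 1 ⟧
    n+0≡n : ⟦ n ℕ.+ 0 ⟧ ≡ ⟦ n ⟧
    n+0≡n = cong ⟦_⟧ (ℕ.+-identityʳ n)
    n+0+1≡n+1 : ⟦ n ℕ.+ 0 ℕ.+ 1 ⟧ ≡ ⟦ n ⟧ + 1ℚ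
    n+0+1≡n+1 = trans (⟦+⟧ (n ℕ.+ 0) 1) (cong (_+ 1ℚ) n+0≡n)
    regroup : ∀ h F r t s → h * F * (1ℚ * r) * (t * s) ≡ h * t * F * (r * s)
    regroup = solve-∀ ℚ-ring

  c-suc-odd : ∀ m k .{{_ : NonZero k}} → let n = suc (2 ℕ.* m) in
              c (suc n) k * (⟦ 2 ⟧ * (⟦ 2 ⟧ * ⟦ k ⟧ + ⟦ n ⟧)) ≡ c n k * (⟦ k ⟧ + ⟦ n ⟧)
  c-suc-odd m = ≡-by-recurrence {f} {g} u v (λ k → 2*+-≢0 k n) f-rec g-rec base
    where
    n = suc (2 ℕ.* m)
    N = ⟦ n ⟧
    u v f g : ℕ → ℚ
    u k = ⟦ 2 ⟧ * ⟦ k ⟧ + N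
    v k = ⟦ k ⟧ + N + 1ℚ
    f k = c (suc n) k * (⟦ 2 ⟧ * u k)
    g k = c n k * (⟦ k ⟧ + N)
    f-rec : ∀ k .{{_ : NonZero k}} → f (suc k) * u k ≡ f k * v k
    f-rec k = begin
      c (suc n) (suc k) * (⟦ 2 ⟧ * u (suc k)) * u k              ≡⟨ regroup (c (suc n) (suc k)) ⟦ k ⟧ N (⟦suc⟧ k) (⟦suc⟧ n) ⟩
      c (suc n) (suc k) * (⟦ 2 ⟧ * ⟦ k ⟧ + ⟦ suc n ⟧ + 1ℚ) * (⟦ 2 ⟧ * u k)
                                                                 ≡⟨ cong (_* (⟦ 2 ⟧ * u k)) (c-even-suc-arg m k) ⟩
      c (suc n) k * (⟦ k ⟧ + ⟦ suc n ⟧) * (⟦ 2 ⟧ * u k)          ≡⟨ rearrange (c (suc n) k) ⟦ k ⟧ N (⟦suc⟧ n) ⟩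
      c (suc n) k * (⟦ 2 ⟧ * u k) * v k                          ∎
      where
      regroup : ∀ x K N {K′ N′} → K′ ≡ K + 1ℚ → N′ ≡ N + 1ℚ →
                x * (⟦ 2 ⟧ * (⟦ 2 ⟧ * K′ + N)) * (⟦ 2 ⟧ * K + N) ≡ x * (⟦ 2 ⟧ * K + N′ + 1ℚ) * (⟦ 2 ⟧ * (⟦ 2 ⟧ * K + N))
      regroup x K N refl refl = solve (x ∷ K ∷ N ∷ []) ℚ-ring
      rearrange : ∀ x K N {N′} → N′ ≡ N + 1ℚ →
                  x * (K + N′) * (⟦ 2 ⟧ * (⟦ 2 ⟧ * K + N)) ≡ x * (⟦ 2 ⟧ * (⟦ 2 ⟧ * K + N)) * (K + N + 1ℚ)
      rearrange x K N refl = solve (x ∷ K ∷ N ∷ []) ℚ-ring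
    g-rec : ∀ k .{{_ : NonZero k}} → g (suc k) * u k ≡ g k * v k
    g-rec k = begin
      c n (suc k) * (⟦ suc k ⟧ + N) * u k     ≡⟨ swap (c n (suc k)) (⟦ suc k ⟧ + N) (u k) ⟩
      c n (suc k) * u k * (⟦ suc k ⟧ + N)     ≡⟨ cong₂ _*_ (c-odd-suc-arg m k) (cong (_+ N) (⟦suc⟧ k)) ⟩
      c n k * (⟦ k ⟧ + N) * (⟦ k ⟧ + 1ℚ + N)  ≡⟨ reorder (c n k * (⟦ k ⟧ + N)) ⟦ k ⟧ N ⟩
      c n k * (⟦ k ⟧ + N) * v k               ∎
      where
      swap : ∀ x a b → x * a * b ≡ x * b * a
      swap = solve-∀ ℚ-ring
      reorder : ∀ x K N → x * (K + 1ℚ + N) ≡ x * (K + N + 1ℚ)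
      reorder = solve-∀ ℚ-ring
    base : f 1 ≡ g 1
    base = begin
      c (suc n) 1 * (⟦ 2 ⟧ * (⟦ 2 ⟧ * ⟦ 1 ⟧ + N))   ≡⟨ cong (c (suc n) 1 *_) (regroup N (⟦suc⟧ n)) ⟩
      c (suc n) 1 * (⟦ 2 ⟧ * (⟦ suc n ⟧ + 1ℚ))    ≡⟨ c-even-one m ⟩
      ⟦ m ! ⟧ * ⟦ suc n ⟧                         ≡⟨ cong₂ _*_ (c-odd-one m) (sym (⟦+⟧ 1 n)) ⟨
      c n 1 * (⟦ 1 ⟧ + N)                         ∎
      where
      regroup : ∀ N {N′} → N′ ≡ N + 1ℚ → ⟦ 2 ⟧ * (⟦ 2 ⟧ * ⟦ 1 ⟧ + N) ≡ ⟦ 2 ⟧ * (N′ + 1ℚ)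
      regroup N refl = solve (N ∷ []) ℚ-ring

  c-suc-even : ∀ m k .{{_ : NonZero k}} → let n = 2 ℕ.+ 2 ℕ.* m in c (suc n) k ≡ (⟦ k ⟧ + ⟦ n ⟧) * c n k
  c-suc-even m = ≡-by-recurrence {f} {g} u v (λ k → 2*+-≢0 k (suc n)) f-rec g-rec base
    where
    n = 2 ℕ.+ 2 ℕ.* m
    N = ⟦ n ⟧
    n+1≡1+2[1+m] : suc n ≡ suc (2 ℕ.* suc m)
    n+1≡1+2[1+m] = cong suc (sym (ℕ.*-suc 2 m))
    u v f g : ℕ → ℚ
    u k = ⟦ 2 ⟧ * ⟦ k ⟧ + ⟦ suc n ⟧
    v k = ⟦ k ⟧ + ⟦ suc n ⟧
    f k = c (suc n) k
    g k = (⟦ k ⟧ + N) * c n k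
    f-rec : ∀ k .{{_ : NonZero k}} → f (suc k) * u k ≡ f k * v k
    f-rec k = subst (λ n′ → c n′ (suc k) * (⟦ 2 ⟧ * ⟦ k ⟧ + ⟦ n′ ⟧) ≡ c n′ k * (⟦ k ⟧ + ⟦ n′ ⟧))
                    (sym n+1≡1+2[1+m]) (c-odd-suc-arg (suc m) k)
    g-rec : ∀ k .{{_ : NonZero k}} → g (suc k) * u k ≡ g k * v k
    g-rec k = begin
      (⟦ suc k ⟧ + N) * c n (suc k) * u k                   ≡⟨ regroup (c n (suc k)) ⟦ k ⟧ N (⟦suc⟧ k) (⟦suc⟧ n) ⟩
      (⟦ k ⟧ + ⟦ suc n ⟧) * (c n (suc k) * (⟦ 2 ⟧ * ⟦ k ⟧ + N + 1ℚ))
                                                            ≡⟨ cong ((⟦ k ⟧ + ⟦ suc n ⟧) *_) (c-even-suc-arg m k) ⟩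
      (⟦ k ⟧ + ⟦ suc n ⟧) * (c n k * (⟦ k ⟧ + N))           ≡⟨ swap (⟦ k ⟧ + ⟦ suc n ⟧) (c n k) (⟦ k ⟧ + N) ⟩
      (⟦ k ⟧ + N) * c n k * (⟦ k ⟧ + ⟦ suc n ⟧)             ∎
      where
      regroup : ∀ x K N {K′ N′} → K′ ≡ K + 1ℚ → N′ ≡ N + 1ℚ →
                (K′ + N) * x * (⟦ 2 ⟧ * K + N′) ≡ (K + N′) * (x * (⟦ 2 ⟧ * K + N + 1ℚ))
      regroup x K N refl refl = solve (x ∷ K ∷ N ∷ []) ℚ-ring
      swap : ∀ a x b → a * (x * b) ≡ b * x * a
      swap = solve-∀ ℚ-ring
    base : f 1 ≡ g 1
    base = *-cancelʳ-≡ ⟦ 2 ⟧ (⟦⟧≢0 2) (begin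
      c (suc n) 1 * ⟦ 2 ⟧                 ≡⟨ cong (λ n′ → c n′ 1 * ⟦ 2 ⟧) n+1≡1+2[1+m] ⟩
      c (suc (2 ℕ.* suc m)) 1 * ⟦ 2 ⟧     ≡⟨ cong (_* ⟦ 2 ⟧) (c-odd-one (suc m)) ⟩
      ⟦ suc m ! ⟧ * ⟦ 2 ⟧                 ≡⟨ ⟦suc!⟧*2 m ⟩
      ⟦ m ! ⟧ * N                         ≡⟨ c-even-one m ⟨
      c n 1 * (⟦ 2 ⟧ * (N + 1ℚ))          ≡⟨ rearrange (c n 1) N ⟩
      (⟦ 1 ⟧ + N) * c n 1 * ⟦ 2 ⟧         ∎)
      where
      rearrange : ∀ x N → x * (⟦ 2 ⟧ * (N + 1ℚ)) ≡ (⟦ 1 ⟧ + N) * x * ⟦ 2 ⟧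
      rearrange = solve-∀ ℚ-ring

  c-odd-≢0 : ∀ m k .{{_ : NonZero k}} → c (suc (2 ℕ.* m)) k ≢ 0ℚ
  c-odd-≢0 m = ≢0-by-recurrence {λ k → c n k} (λ k → ⟦ 2 ⟧ * ⟦ k ⟧ + ⟦ n ⟧) (λ k → ⟦ k ⟧ + ⟦ n ⟧) (λ k → +-≢0 k n)
                                 (c-odd-suc-arg m) (subst (_≢ 0ℚ) (sym (c-odd-one m)) (⟦!⟧≢0 m))
    where n = suc (2 ℕ.* m)

  c-even-≢0 : ∀ m k .{{_ : NonZero k}} → c (2 ℕ.+ 2 ℕ.* m) k ≢ 0ℚ
  c-even-≢0 m = ≢0-by-recurrence {λ k → c n k} (λ k → ⟦ 2 ⟧ * ⟦ k ⟧ + ⟦ n ⟧ + 1ℚ) (λ k → ⟦ k ⟧ + ⟦ n ⟧) (λ k → +-≢0 k n)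
                                  (c-even-suc-arg m) c₁≢0
    where
    n = 2 ℕ.+ 2 ℕ.* m
    c₁≢0 : c n 1 ≢ 0ℚ
    c₁≢0 c₁≡0 = *-≢0 (⟦!⟧≢0 m) (⟦⟧≢0 n)
                     (trans (sym (c-even-one m)) (trans (cong (_* w) c₁≡0) (*-zeroˡ w)))
      where w = ⟦ 2 ⟧ * (⟦ n ⟧ + 1ℚ)

  c-≢0 : ∀ n k .{{_ : NonZero k}} → c (suc n) k ≢ 0ℚ
  c-≢0 n k with even-or-odd n
  ... | m , inj₁ refl = c-odd-≢0 m k
  ... | m , inj₂ refl = c-even-≢0 m k

  -- The identity relating ℓ to c

  c-A-recurrence : ∀ n (γ d : ℕ → ℚ) → (∀ k → .{{_ : NonZero k}} → γ (suc k) * d k ≡ γ k * (⟦ k ⟧ + ⟦ n ⟧)) →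
                   ∀ k .{{_ : NonZero k}} →
                   γ (suc k) * (⟦ suc k ⟧ + ⟦ n ⟧) * A (suc n) (suc k) * d k
                   ≡ γ k * (⟦ k ⟧ + ⟦ n ⟧) * A (suc n) k * ((⟦ 2 ⟧ * ⟦ k ⟧ + ⟦ n ⟧ + 1ℚ) * (⟦ 2 ⟧ * ⟦ k ⟧ + ⟦ n ⟧))
  c-A-recurrence n γ d γ-rec k = begin
    γ (suc k) * (⟦ suc k ⟧ + N) * A (suc n) (suc k) * d k
      ≡⟨ cong₂ (λ x a → γ (suc k) * (x + N) * a * d k) (⟦suc⟧ k) (A-suc-arg n k) ⟩
    γ (suc k) * (K + 1ℚ + N) * ((⟦ 2 ⟧ * K + N + 1ℚ) * A (2 ℕ.+ n) k) * d k
      ≡⟨ regroup (γ (suc k)) (d k) K N (A (2 ℕ.+ n) k) ⟩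
    γ (suc k) * d k * (⟦ 2 ⟧ * K + N + 1ℚ) * (A (2 ℕ.+ n) k * (K + N + 1ℚ))
      ≡⟨ cong₂ (λ x y → x * (⟦ 2 ⟧ * K + N + 1ℚ) * y) (γ-rec k) (A-suc-index n k) ⟩
    γ k * (K + N) * (⟦ 2 ⟧ * K + N + 1ℚ) * (A (suc n) k * (⟦ 2 ⟧ * K + N))
      ≡⟨ rearrange (γ k * (K + N)) (⟦ 2 ⟧ * K + N + 1ℚ) (A (suc n) k) (⟦ 2 ⟧ * K + N) ⟩
    γ k * (K + N) * A (suc n) k * ((⟦ 2 ⟧ * K + N + 1ℚ) * (⟦ 2 ⟧ * K + N)) ∎
    where
    K = ⟦ k ⟧
    N = ⟦ n ⟧
    regroup : ∀ x y K N a → x * (K + 1ℚ + N) * ((⟦ 2 ⟧ * K + N + 1ℚ) * a) * y ≡ x * y * (⟦ 2 ⟧ * K + N + 1ℚ) * (a * (K + N + 1ℚ))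
    regroup = solve-∀ ℚ-ring
    rearrange : ∀ x s a t → x * s * (a * t) ≡ x * a * (s * t)
    rearrange = solve-∀ ℚ-ring

  ℓ-identity-odd : ∀ m k .{{_ : NonZero k}} → let n = suc (2 ℕ.* m) in
                   ⟦ 2 ⟧ * (⟦ k ⟧ * ⟦ dfact k ⟧ * rising ⟦ k ⟧ m) ≡ c n k * (⟦ k ⟧ + ⟦ n ⟧) * A (suc n) k
  ℓ-identity-odd m = ≡-by-recurrence {f} {g} u v (λ k → 2*+-≢0 k n) f-rec (c-A-recurrence n (c n) u (c-odd-suc-arg m)) base
    where
    n = suc (2 ℕ.* m)
    N = ⟦ n ⟧
    u v f g : ℕ → ℚ
    u k = ⟦ 2 ⟧ * ⟦ k ⟧ + N
    v k = (⟦ 2 ⟧ * ⟦ k ⟧ + N + 1ℚ) * (⟦ 2 ⟧ * ⟦ k ⟧ + N)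
    f k = ⟦ 2 ⟧ * (⟦ k ⟧ * ⟦ dfact k ⟧ * rising ⟦ k ⟧ m)
    g k = c n k * (⟦ k ⟧ + N) * A (suc n) k
    f-rec : ∀ k .{{_ : NonZero k}} → f (suc k) * u k ≡ f k * v k
    f-rec k = trans (cong (λ x → ⟦ 2 ⟧ * x * u k) (dfact-rising-suc m k))
                    (regroup (⟦ k ⟧ * ⟦ dfact k ⟧ * rising ⟦ k ⟧ m) ⟦ k ⟧ ⟦ m ⟧ (trans (⟦suc⟧ (2 ℕ.* m)) (cong (_+ 1ℚ) (⟦*⟧ 2 m))))
      where
      regroup : ∀ X K M {N} → N ≡ ⟦ 2 ⟧ * M + 1ℚ →
                ⟦ 2 ⟧ * (⟦ 2 ⟧ * (K + M + 1ℚ) * X) * (⟦ 2 ⟧ * K + N) ≡ ⟦ 2 ⟧ * X * ((⟦ 2 ⟧ * K + N + 1ℚ) * (⟦ 2 ⟧ * K + N))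
      regroup X K M refl = solve (X ∷ K ∷ M ∷ []) ℚ-ring
    base : f 1 ≡ g 1
    base = begin
      ⟦ 2 ⟧ * (⟦ 1 ⟧ * ⟦ dfact 1 ⟧ * rising 1ℚ m)     ≡⟨ cong (λ r → ⟦ 2 ⟧ * (1ℚ * 1ℚ * r)) (rising-one m) ⟩
      ⟦ 2 ⟧ * (1ℚ * 1ℚ * ⟦ suc m ! ⟧)                  ≡⟨ reorder ⟦ suc m ! ⟧ ⟩
      ⟦ suc m ! ⟧ * ⟦ 2 ⟧                              ≡⟨ ⟦suc!⟧*2 m ⟩
      ⟦ m ! ⟧ * ⟦ suc n ⟧                              ≡⟨ cong₂ _*_ (sym (c-odd-one m)) (⟦+⟧ 1 n) ⟩
      c n 1 * (⟦ 1 ⟧ + N)                              ≡⟨ *-identityʳ (c n 1 * (⟦ 1 ⟧ + N)) ⟨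
      c n 1 * (⟦ 1 ⟧ + N) * 1ℚ                         ≡⟨ cong (c n 1 * (⟦ 1 ⟧ + N) *_) (fact-ratio-self (suc n)) ⟨
      c n 1 * (⟦ 1 ⟧ + N) * A (suc n) 1                ∎
      where
      reorder : ∀ x → ⟦ 2 ⟧ * (1ℚ * 1ℚ * x) ≡ x * ⟦ 2 ⟧
      reorder = solve-∀ ℚ-ring

  ℓ-identity-even : ∀ m k .{{_ : NonZero k}} → let n = 2 ℕ.+ 2 ℕ.* m in
                    ⟦ k ⟧ * ⟦ dfact k ⟧ * rising ⟦ k ⟧ m ≡ c n k * (⟦ k ⟧ + ⟦ n ⟧) * A (suc n) k
  ℓ-identity-even m = ≡-by-recurrence {f} {g} u v (λ k → 2*++1-≢0 k n) f-rec (c-A-recurrence n (c n) u (c-even-suc-arg m)) base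
    where
    n = 2 ℕ.+ 2 ℕ.* m
    N = ⟦ n ⟧
    u v f g : ℕ → ℚ
    u k = ⟦ 2 ⟧ * ⟦ k ⟧ + N + 1ℚ
    v k = (⟦ 2 ⟧ * ⟦ k ⟧ + N + 1ℚ) * (⟦ 2 ⟧ * ⟦ k ⟧ + N)
    f k = ⟦ k ⟧ * ⟦ dfact k ⟧ * rising ⟦ k ⟧ m
    g k = c n k * (⟦ k ⟧ + N) * A (suc n) k
    f-rec : ∀ k .{{_ : NonZero k}} → f (suc k) * u k ≡ f k * v k
    f-rec k = trans (cong (_* u k) (dfact-rising-suc m k))
                    (regroup (f k) ⟦ k ⟧ ⟦ m ⟧ (trans (⟦+⟧ 2 (2 ℕ.* m)) (cong (⟦ 2 ⟧ +_) (⟦*⟧ 2 m))))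
      where
      regroup : ∀ X K M {N} → N ≡ ⟦ 2 ⟧ + ⟦ 2 ⟧ * M →
                ⟦ 2 ⟧ * (K + M + 1ℚ) * X * (⟦ 2 ⟧ * K + N + 1ℚ) ≡ X * ((⟦ 2 ⟧ * K + N + 1ℚ) * (⟦ 2 ⟧ * K + N))
      regroup X K M refl = solve (X ∷ K ∷ M ∷ []) ℚ-ring
    base : f 1 ≡ g 1
    base = *-cancelʳ-≡ ⟦ 2 ⟧ (⟦⟧≢0 2) (begin
      ⟦ 1 ⟧ * ⟦ dfact 1 ⟧ * rising 1ℚ m * ⟦ 2 ⟧        ≡⟨ cong (λ r → 1ℚ * 1ℚ * r * ⟦ 2 ⟧) (rising-one m) ⟩
      1ℚ * 1ℚ * ⟦ suc m ! ⟧ * ⟦ 2 ⟧                   ≡⟨ cong (_* ⟦ 2 ⟧) (unit ⟦ suc m ! ⟧) ⟩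
      ⟦ suc m ! ⟧ * ⟦ 2 ⟧                             ≡⟨ ⟦suc!⟧*2 m ⟩
      ⟦ m ! ⟧ * N                                     ≡⟨ c-even-one m ⟨
      c n 1 * (⟦ 2 ⟧ * (N + 1ℚ))                      ≡⟨ rearrange (c n 1) N ⟩
      c n 1 * (⟦ 1 ⟧ + N) * 1ℚ * ⟦ 2 ⟧                ≡⟨ cong (λ a → c n 1 * (⟦ 1 ⟧ + N) * a * ⟦ 2 ⟧) (fact-ratio-self (suc n)) ⟨
      c n 1 * (⟦ 1 ⟧ + N) * A (suc n) 1 * ⟦ 2 ⟧       ∎)
      where
      unit : ∀ x → 1ℚ * 1ℚ * x ≡ x
      unit = solve-∀ ℚ-ring
      rearrange : ∀ x N → x * (⟦ 2 ⟧ * (N + 1ℚ)) ≡ x * (⟦ 1 ⟧ + N) * 1ℚ * ⟦ 2 ⟧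
      rearrange = solve-∀ ℚ-ring

  -- The closed form of P

  ClosedForm : ℕ → Set
  ClosedForm n = ∀ k .{{_ : NonZero k}} → ⟦ dfact k ⟧ * P n ⟦ k ⟧ ≡ c n k * T n k

  -- P₂ = 1 is also what the odd recursion step produces from P₁.
  P-suc : ∀ n k → P (2 ℕ.+ n) ⟦ k ⟧ ≡ step (suc n) (P (suc n)) ⟦ k ⟧
  P-suc zero k = sym (*-cancelʳ-≡ den den≢0 (begin
    X ÷' den * den    ≡⟨ ÷'-*-cancel X den≢0 ⟩
    X                 ≡⟨ X≡den ⟦ k ⟧ ⟩
    den               ≡⟨ *-identityˡ den ⟨
    1ℚ * den          ∎))
    where
    K = ⟦ k ⟧
    den = ⟦ 4 ⟧ * (⟦ 2 ⟧ * K + ⟦ 1 ⟧)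
    X = ⟦ 2 ⟧ * (K + ⟦ 1 ⟧) * 1ℚ + (⟦ 2 ⟧ * K + ⟦ 1 ⟧) * 1ℚ + (⟦ 4 ⟧ * K + ⟦ 1 ⟧) * 1ℚ
    den≢0 = *-≢0 (⟦⟧≢0 4) (2*+-≢0 k 1)
    X≡den : ∀ K → ⟦ 2 ⟧ * (K + ⟦ 1 ⟧) * 1ℚ + (⟦ 2 ⟧ * K + ⟦ 1 ⟧) * 1ℚ + (⟦ 4 ⟧ * K + ⟦ 1 ⟧) * 1ℚ ≡ ⟦ 4 ⟧ * (⟦ 2 ⟧ * K + ⟦ 1 ⟧)
    X≡den = solve-∀ ℚ-ring
  P-suc (suc n) k = refl

  closed-at-suc : ∀ {n} → ClosedForm n → ∀ k .{{_ : NonZero k}} →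
                  ⟦ 2 ⟧ * ⟦ k ⟧ * ⟦ dfact k ⟧ * P n (⟦ k ⟧ + 1ℚ) ≡ c n (suc k) * (⟦ 4 ⟧ * ⟦ k ⟧ * T n k - ⟦ n ⟧ * A (suc n) k)
  closed-at-suc {n} closed k = begin
    ⟦ 2 ⟧ * ⟦ k ⟧ * ⟦ dfact k ⟧ * P n (⟦ k ⟧ + 1ℚ)   ≡⟨ cong₂ (λ d x → d * P n x) (dfact-suc k) (⟦suc⟧ k) ⟨
    ⟦ dfact (suc k) ⟧ * P n ⟦ suc k ⟧               ≡⟨ closed (suc k) ⟩
    c n (suc k) * T n (suc k)                       ≡⟨ cong (c n (suc k) *_) (T-suc-arg n k) ⟩
    c n (suc k) * (⟦ 4 ⟧ * ⟦ k ⟧ * T n k - ⟦ n ⟧ * A (suc n) k) ∎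

  -- D_k times the numerator of the recursion for P_{n+1}(k), with ε = 1 for odd n and ε = 2 for even n.
  numerator-identity : ∀ ε σ d K N D P₀ P₁ L c₀ c₁ T₀ A → K ≢ 0ℚ →
                       D * P₀ ≡ c₀ * T₀ →
                       ⟦ 2 ⟧ * K * D * P₁ ≡ c₁ * (⟦ 4 ⟧ * K * T₀ - N * A) →
                       c₁ * d ≡ c₀ * σ →
                       ⟦ 2 ⟧ * (K * D * L) ≡ ε * (c₀ * σ * A) →
                       D * (⟦ 2 ⟧ * ε * σ * P₀ + ε * d * P₁ + (⟦ 4 ⟧ * K + N) * L) ≡ ⟦ 2 ⟧ * ε * (c₀ * σ) * (⟦ 2 ⟧ * T₀ + A)
  numerator-identity ε σ d K N D P₀ P₁ L c₀ c₁ T₀ A K≢0 h₀ h₁ hc hL =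
    *-cancelʳ-≡ (⟦ 2 ⟧ * K) (*-≢0 (⟦⟧≢0 2) K≢0) (begin
      D * (⟦ 2 ⟧ * ε * σ * P₀ + ε * d * P₁ + (⟦ 4 ⟧ * K + N) * L) * (⟦ 2 ⟧ * K)
        ≡⟨ solve (ε ∷ σ ∷ d ∷ K ∷ N ∷ D ∷ P₀ ∷ P₁ ∷ L ∷ []) ℚ-ring ⟩
      ⟦ 2 ⟧ * ε * σ * (⟦ 2 ⟧ * K) * (D * P₀) + ε * d * (⟦ 2 ⟧ * K * D * P₁) + (⟦ 4 ⟧ * K + N) * (⟦ 2 ⟧ * (K * D * L))
        ≡⟨ cong₂ (λ x y → ⟦ 2 ⟧ * ε * σ * (⟦ 2 ⟧ * K) * x + ε * d * y + (⟦ 4 ⟧ * K + N) * (⟦ 2 ⟧ * (K * D * L))) h₀ h₁ ⟩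
      ⟦ 2 ⟧ * ε * σ * (⟦ 2 ⟧ * K) * (c₀ * T₀) + ε * d * (c₁ * (⟦ 4 ⟧ * K * T₀ - N * A)) + (⟦ 4 ⟧ * K + N) * (⟦ 2 ⟧ * (K * D * L))
        ≡⟨ cong (λ z → ⟦ 2 ⟧ * ε * σ * (⟦ 2 ⟧ * K) * (c₀ * T₀) + ε * d * (c₁ * (⟦ 4 ⟧ * K * T₀ - N * A)) + (⟦ 4 ⟧ * K + N) * z) hL ⟩
      ⟦ 2 ⟧ * ε * σ * (⟦ 2 ⟧ * K) * (c₀ * T₀) + ε * d * (c₁ * (⟦ 4 ⟧ * K * T₀ - N * A)) + (⟦ 4 ⟧ * K + N) * (ε * (c₀ * σ * A))
        ≡⟨ solve (ε ∷ σ ∷ d ∷ K ∷ N ∷ c₀ ∷ c₁ ∷ T₀ ∷ A ∷ []) ℚ-ring ⟩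
      ⟦ 2 ⟧ * ε * σ * (⟦ 2 ⟧ * K) * (c₀ * T₀) + ε * (c₁ * d) * (⟦ 4 ⟧ * K * T₀ - N * A) + (⟦ 4 ⟧ * K + N) * (ε * (c₀ * σ * A))
        ≡⟨ cong (λ z → ⟦ 2 ⟧ * ε * σ * (⟦ 2 ⟧ * K) * (c₀ * T₀) + ε * z * (⟦ 4 ⟧ * K * T₀ - N * A) + (⟦ 4 ⟧ * K + N) * (ε * (c₀ * σ * A))) hc ⟩
      ⟦ 2 ⟧ * ε * σ * (⟦ 2 ⟧ * K) * (c₀ * T₀) + ε * (c₀ * σ) * (⟦ 4 ⟧ * K * T₀ - N * A) + (⟦ 4 ⟧ * K + N) * (ε * (c₀ * σ * A))
        ≡⟨ solve (ε ∷ σ ∷ K ∷ N ∷ c₀ ∷ T₀ ∷ A ∷ []) ℚ-ring ⟩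
      ⟦ 2 ⟧ * ε * (c₀ * σ) * (⟦ 2 ⟧ * T₀ + A) * (⟦ 2 ⟧ * K) ∎)

  closed-form-suc-odd : ∀ m → ClosedForm (suc (2 ℕ.* m)) → ClosedForm (2 ℕ.+ 2 ℕ.* m)
  closed-form-suc-odd m closed k = *-cancelʳ-≡ den den≢0 (begin
    D * P (suc n) K * den          ≡⟨ cong (λ p → D * p * den) (trans (P-suc (2 ℕ.* m) k) (if-true (odd-1+2m m))) ⟩
    D * (X ÷' den) * den           ≡⟨ *-assoc D (X ÷' den) den ⟩
    D * (X ÷' den * den)           ≡⟨ cong (D *_) (trans (÷'-*-cancel X den≢0) numerator) ⟩
    D * (⟦ 2 ⟧ * 1ℚ * σ * P₀ + 1ℚ * d * P₁ + (⟦ 4 ⟧ * K + N) * rising K m)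
                                   ≡⟨ numerator-identity 1ℚ σ d K N D P₀ P₁ (rising K m) (c n k) (c n (suc k)) (T n k) (A (suc n) k)
                                                (⟦⟧≢0 k) (closed k) (closed-at-suc {n} closed k) (c-odd-suc-arg m k) ℓ-term ⟩
    ⟦ 2 ⟧ * 1ℚ * (c n k * σ) * (⟦ 2 ⟧ * T n k + A (suc n) k)
                                   ≡⟨ cong₂ (λ x t → ⟦ 2 ⟧ * 1ℚ * x * t) (c-suc-odd m k) (T-suc n k) ⟨
    ⟦ 2 ⟧ * 1ℚ * (c (suc n) k * (⟦ 2 ⟧ * d)) * T (suc n) k
                                   ≡⟨ regroup (c (suc n) k) (T (suc n) k) d ⟩
    c (suc n) k * T (suc n) k * den ∎)
    where
    n = suc (2 ℕ.* m)
    K = ⟦ k ⟧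
    N = ⟦ n ⟧
    D = ⟦ dfact k ⟧
    P₀ = P n K
    P₁ = P n (K + 1ℚ)
    σ = K + N
    d = ⟦ 2 ⟧ * K + N
    den = ⟦ 4 ⟧ * d
    den≢0 = *-≢0 (⟦⟧≢0 4) (2*+-≢0 k n)
    X = ⟦ 2 ⟧ * σ * P₀ + d * P₁ + (⟦ 4 ⟧ * K + N) * ℓ n K
    numerator : X ≡ ⟦ 2 ⟧ * 1ℚ * σ * P₀ + 1ℚ * d * P₁ + (⟦ 4 ⟧ * K + N) * rising K m
    numerator = trans (cong (λ l → ⟦ 2 ⟧ * σ * P₀ + d * P₁ + (⟦ 4 ⟧ * K + N) * l) (ℓ-odd m K))
                      (insert-ones σ d P₀ P₁ ((⟦ 4 ⟧ * K + N) * rising K m))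
      where
      insert-ones : ∀ σ d P₀ P₁ x → ⟦ 2 ⟧ * σ * P₀ + d * P₁ + x ≡ ⟦ 2 ⟧ * 1ℚ * σ * P₀ + 1ℚ * d * P₁ + x
      insert-ones = solve-∀ ℚ-ring
    ℓ-term : ⟦ 2 ⟧ * (K * D * rising K m) ≡ 1ℚ * (c n k * σ * A (suc n) k)
    ℓ-term = trans (ℓ-identity-odd m k) (sym (*-identityˡ (c n k * σ * A (suc n) k)))
    regroup : ∀ x t d → ⟦ 2 ⟧ * 1ℚ * (x * (⟦ 2 ⟧ * d)) * t ≡ x * t * (⟦ 4 ⟧ * d)
    regroup = solve-∀ ℚ-ring

  closed-form-suc-even : ∀ m → ClosedForm (2 ℕ.+ 2 ℕ.* m) → ClosedForm (3 ℕ.+ 2 ℕ.* m)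
  closed-form-suc-even m closed k = *-cancelʳ-≡ ⟦ 4 ⟧ (⟦⟧≢0 4) (begin
    D * P (suc n) K * ⟦ 4 ⟧        ≡⟨ cong (λ p → D * p * ⟦ 4 ⟧) (if-false (odd-2+2m m)) ⟩
    D * (X ÷' ⟦ 4 ⟧) * ⟦ 4 ⟧       ≡⟨ *-assoc D (X ÷' ⟦ 4 ⟧) ⟦ 4 ⟧ ⟩
    D * (X ÷' ⟦ 4 ⟧ * ⟦ 4 ⟧)       ≡⟨ cong (D *_) (trans (÷'-*-cancel X (⟦⟧≢0 4)) numerator) ⟩
    D * (⟦ 2 ⟧ * ⟦ 2 ⟧ * σ * P₀ + ⟦ 2 ⟧ * d * P₁ + (⟦ 4 ⟧ * K + N) * rising K m)
                                   ≡⟨ numerator-identity ⟦ 2 ⟧ σ d K N D P₀ P₁ (rising K m) (c n k) (c n (suc k)) (T n k) (A (suc n) k)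
                                                (⟦⟧≢0 k) (closed k) (closed-at-suc {n} closed k) (c-even-suc-arg m k)
                                                (cong (⟦ 2 ⟧ *_) (ℓ-identity-even m k)) ⟩
    ⟦ 2 ⟧ * ⟦ 2 ⟧ * (c n k * σ) * (⟦ 2 ⟧ * T n k + A (suc n) k)
                                   ≡⟨ cong₂ (λ x t → ⟦ 2 ⟧ * ⟦ 2 ⟧ * x * t)
                                            (trans (*-comm (c n k) σ) (sym (c-suc-even m k))) (sym (T-suc n k)) ⟩
    ⟦ 2 ⟧ * ⟦ 2 ⟧ * c (suc n) k * T (suc n) k
                                   ≡⟨ regroup (c (suc n) k) (T (suc n) k) ⟩
    c (suc n) k * T (suc n) k * ⟦ 4 ⟧ ∎)
    where
    n = 2 ℕ.+ 2 ℕ.* m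
    K = ⟦ k ⟧
    N = ⟦ n ⟧
    D = ⟦ dfact k ⟧
    P₀ = P n K
    P₁ = P n (K + 1ℚ)
    σ = K + N
    d = ⟦ 2 ⟧ * K + N + 1ℚ
    X = ⟦ 4 ⟧ * σ * P₀ + ⟦ 2 ⟧ * d * P₁ + (⟦ 4 ⟧ * K + N) * ℓ (suc (2 ℕ.* m)) K
    numerator : X ≡ ⟦ 2 ⟧ * ⟦ 2 ⟧ * σ * P₀ + ⟦ 2 ⟧ * d * P₁ + (⟦ 4 ⟧ * K + N) * rising K m
    numerator = trans (cong (λ l → ⟦ 4 ⟧ * σ * P₀ + ⟦ 2 ⟧ * d * P₁ + (⟦ 4 ⟧ * K + N) * l) (ℓ-odd m K))
                      (split-four σ P₀ (⟦ 2 ⟧ * d * P₁) ((⟦ 4 ⟧ * K + N) * rising K m))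
      where
      split-four : ∀ σ P₀ x y → ⟦ 4 ⟧ * σ * P₀ + x + y ≡ ⟦ 2 ⟧ * ⟦ 2 ⟧ * σ * P₀ + x + y
      split-four = solve-∀ ℚ-ring
    regroup : ∀ x t → ⟦ 2 ⟧ * ⟦ 2 ⟧ * x * t ≡ x * t * ⟦ 4 ⟧
    regroup = solve-∀ ℚ-ring

  closed-form-one : ClosedForm 1
  closed-form-one k = *-cancelʳ-≡ z z≢0 (begin
    ⟦ dfact k ⟧ * 1ℚ * z                                  ≡⟨ regroup₁ K ⟦ dfact k ⟧ ⟩
    ⟦ 2 ⟧ * (K * ⟦ dfact k ⟧ * 1ℚ) * (K + ⟦ 1 ⟧)          ≡⟨ cong (_* (K + ⟦ 1 ⟧)) (ℓ-identity-odd 0 k) ⟩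
    c 1 k * (K + ⟦ 1 ⟧) * A 2 k * (K + ⟦ 1 ⟧)             ≡⟨ regroup₂ (c 1 k) K (A 2 k) ⟩
    c 1 k * (K + ⟦ 1 ⟧) * (A 2 k * (K + ⟦ 0 ⟧ + 1ℚ))      ≡⟨ cong (c 1 k * (K + ⟦ 1 ⟧) *_) (A-suc-index 0 k) ⟩
    c 1 k * (K + ⟦ 1 ⟧) * (A 1 k * (⟦ 2 ⟧ * K + ⟦ 0 ⟧))   ≡⟨ regroup₃ (c 1 k) K (A 1 k) ⟩
    c 1 k * (0ℚ + 1ℚ * A 1 k) * z                         ∎)
    where
    K = ⟦ k ⟧
    z = ⟦ 2 ⟧ * K * (K + 1ℚ)
    z≢0 = *-≢0 (*-≢0 (⟦⟧≢0 2) (⟦⟧≢0 k)) (subst (_≢ 0ℚ) (⟦suc⟧ k) (⟦⟧≢0 (suc k)))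
    regroup₁ : ∀ K D → D * 1ℚ * (⟦ 2 ⟧ * K * (K + 1ℚ)) ≡ ⟦ 2 ⟧ * (K * D * 1ℚ) * (K + ⟦ 1 ⟧)
    regroup₁ = solve-∀ ℚ-ring
    regroup₂ : ∀ x K a → x * (K + ⟦ 1 ⟧) * a * (K + ⟦ 1 ⟧) ≡ x * (K + ⟦ 1 ⟧) * (a * (K + ⟦ 0 ⟧ + 1ℚ))
    regroup₂ = solve-∀ ℚ-ring
    regroup₃ : ∀ x K a → x * (K + ⟦ 1 ⟧) * (a * (⟦ 2 ⟧ * K + ⟦ 0 ⟧)) ≡ x * (0ℚ + 1ℚ * a) * (⟦ 2 ⟧ * K * (K + 1ℚ))
    regroup₃ = solve-∀ ℚ-ring

  closed-form-odd : ∀ m → ClosedForm (suc (2 ℕ.* m))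
  closed-form-odd zero = closed-form-one
  closed-form-odd (suc m) =
    subst ClosedForm (cong suc (sym (ℕ.*-suc 2 m))) (closed-form-suc-even m (closed-form-suc-odd m (closed-form-odd m)))

  closed-form : ∀ n → ClosedForm (suc n)
  closed-form n with even-or-odd n
  ... | m , inj₁ refl = closed-form-odd m
  ... | m , inj₂ refl = closed-form-suc-odd m (closed-form-odd m)

  R-closed-form : ∀ k n .{{_ : NonZero k}} .{{_ : NonZero n}} →
                  R k n ≡ ⟦ 2 ℕ.^ n ℕ.* (k ∸ 1) ! ℕ.* 4 ℕ.^ (k ∸ 1) ⟧ - T n k
  R-closed-form k (suc n) = begin
    ⟦ dfact k ⟧ * (⟦ 2 ℕ.^ (suc n ℕ.+ k ∸ 1) ⟧ - P (suc n) ⟦ k ⟧ ÷' c (suc n) k)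
      ≡⟨ *-[-÷'] ⟦ dfact k ⟧ _ (P (suc n) ⟦ k ⟧) (c (suc n) k) (T (suc n) k) (c-≢0 n k) (closed-form n k) ⟩
    ⟦ dfact k ⟧ * ⟦ 2 ℕ.^ (suc n ℕ.+ k ∸ 1) ⟧ - T (suc n) k
      ≡⟨ cong (_- T (suc n) k) (trans (sym (⟦*⟧ (dfact k) _)) (cong ⟦_⟧ (dfact*2^[n+k-1] k (suc n)))) ⟩
    ⟦ 2 ℕ.^ suc n ℕ.* (k ∸ 1) ! ℕ.* 4 ℕ.^ (k ∸ 1) ⟧ - T (suc n) k ∎

open import Defs
open import Data.Nat using (ℕ; _≤_; _∸_; _+_; _*_; _^_)
open import Data.Nat using (_!)
open import Data.Nat using (>-nonZero)
open import Data.Rational using (ℚ; _-_) renaming (_*_ to _*ℚ_)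
open import Relation.Binary.PropositionalEquality using (_≡_)

theorem4 : (k n : ℕ) → 1 ≤ k → 1 ≤ n →
    R k n ≡ ⟦ 2 ^ n * (k ∸ 1) ! * 4 ^ (k ∸ 1) ⟧
    - ∑[ 1 to n ] (λ i → ⟦ 2 ^ (n ∸ i) ⟧ *ℚ (⟦ (2 * k + i ∸ 2) ! ⟧ ÷' ⟦ (k + i ∸ 1) ! ⟧))
theorem4 k n 1≤k 1≤n = Proof.R-closed-form k n {{>-nonZero 1≤k}} {{>-nonZero 1≤n}}
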